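{- Let $G$ be a finite directed graph, $k\ge1$ an integer, $r\in V(G)$ with positive in-degree and positive out-degree, and $\lambda,\delta\in(0,1)$. Suppose the sampling loop of algorithm APAD (described in the context) is executed a fixed number $\boldsymbol{\tau}$ of times, producing $\mathbf{c}=\frac1{\boldsymbol{\tau}}\sum_{\tau=1}^{\boldsymbol{\tau}}\mathbf{c}_\tau$. Then for all sufficiently large $\boldsymbol{\tau}$, $\mathbf{c}$ is a $(\lambda,\delta)$-approximation of $pc(r)$, i.e. $\mathbb{P}\left[|\mathbf{c}-pc(r)|\ge\lambda\right]\le\delta$.
   Context: $G$ is a finite, unweighted directed graph without self-loops or multiple edges, assumed (weakly) connected. $N(v)$ is the set of out-neighbours of $v$. For a vertex $s$ and integer $l\ge1$, $p_{s,l}$ denotes a simple directed path $s=u_0,u_1,\dots,u_l$ with $l$ edges starting at $s$; define $\mathcal{W}(p_{s,l})=\prod_{i=1}^{l}\frac{1}{|N(u_{i-1})\setminus\{s,u_1,\dots,u_{i-2}\}|}$ (for $i=1$ the removed set is $\{s\}$). $\chi[r\in p_{s,l}]$ is $1$ if $r$ is a vertex of $p_{s,l}$ and $0$ otherwise. The $k$-path centrality of $r$ is $pc(r)=\frac{1}{k|V(G)|}\sum_{s\in V(G)\setminus\{r\}}\sum_{1\le l\le k}\sum_{p_{s,l}}\chi[r\in p_{s,l}]\,\mathcal{W}(p_{s,l})$, the innermost sum over all simple paths with $l$ edges starting at $s$. $\mathcal{RF}(r)$ is the set of vertices $s\ne r$ with a directed path from $s$ to $r$; $\mathcal{RT}(r)$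 is the set of vertices $t\ne r$ with a directed path from $r$ to $t$; $\mathcal{D}(r)=\mathcal{RF}(r)\cup\{r\}\cup\mathcal{RT}(r)$. Algorithm APAD: let $RF=\mathcal{RF}(r)$, $D=\mathcal{D}(r)$. In each iteration $\tau$, independently: choose $s\in RF$ uniformly at random and $l\in\{1,\dots,k\}$ uniformly at random; build a path starting from $u_0=s$ where, for $i=1,\dots,l$, $u_i$ is chosen uniformly at random from $(N(u_{i-1})\cap D)\setminus\{s,u_1,\dots,u_{i-2}\}$; if this set is empty at some step, set $\mathbf{c}_\tau=0$. Otherwise the result is a path $p_{s,l}$ with $\mathbb{P}[p_{s,l}]=\prod_{i=1}^{l}\frac{1}{|(N(u_{i-1})\cap D)\setminus\{s,u_1,\dots,u_{i-2}\}|}$, and set $\mathbf{c}_\tau=\frac{|RF|\,\mathcal{W}(p_{s,l})}{|V(G)|\,\mathbb{P}[p_{s,l}]}$ if $r$ lies on $p_{s,l}$ and $\mathbf{c}_\tau=0$ otherwise.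
   Formalization: The parameters λ and δ are rationals in (0,1) rather than real numbers. -}

module Defs where

open import Data.Bool using (Bool; true; false; _∧_; _∨_; not; if_then_else_)
open import Data.Nat as ℕ using (ℕ; zero; suc)
open import Data.Fin using (Fin; _≟_)
open import Data.List using (List; []; _∷_; [_]; filterᵇ; map; concatMap; length; allFin; foldr; upTo)
open import Data.Maybe using (Maybe; just; nothing)
open import Data.Product using (_×_; _,_; proj₁; proj₂)
open import Data.Integer using (+_)
open import Data.Rational as ℚ using (ℚ; 0ℚ; 1ℚ; _+_; _*_; _/_; 1/_; ≢-nonZero)
open import Relation.Nullary using (yes; no; does)
open import Relation.Unary using (Decidable)
open import Relation.Binary.PropositionalEquality using (_≡_)
open import Relation.Binary.Construct.Closure.ReflexiveTransitive using (Star)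
open import Relation.Binary.Construct.Closure.Symmetric using (SymClosure)

Graph : ℕ → Set
Graph n = Fin n → Fin n → Bool

module _ {n : ℕ} (E : Graph n) where

  Edge : Fin n → Fin n → Set
  Edge u v = E u v ≡ true

  NoSelfLoops : Set
  NoSelfLoops = ∀ v → E v v ≡ false

  -- there is a directed path (equivalently, walk) from u to v
  Reach : Fin n → Fin n → Set
  Reach = Star Edge

  WeaklyConnected : Set
  WeaklyConnected = ∀ u v → Star (SymClosure Edge) u v

_∈ᵇ_ : ∀ {n} → Fin n → List (Fin n) → Bool
v ∈ᵇ [] = false
v ∈ᵇ (x ∷ xs) = does (v ≟ x) ∨ (v ∈ᵇ xs)

Σℚ : List ℚ → ℚ
Σℚ = foldr _+_ 0ℚ

-- 1/m as a rational (0 for m = 0; never used at m = 0 in the relevant places)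
inv : ℕ → ℚ
inv zero = 0ℚ
inv (suc m) = + 1 / suc m

invℚ : ℚ → ℚ
invℚ q with q ℚ.≟ 0ℚ
... | yes _ = 0ℚ
... | no q≢0 = 1/_ q {{≢-nonZero q≢0}}

module Paths {n : ℕ} (E : Graph n) where

  cands : (A : Fin n → Bool) → List (Fin n) → Fin n → List (Fin n)
  cands A R u = filterᵇ (λ v → E u v ∧ A v ∧ not (v ∈ᵇ R)) (allFin n)

  -- All continuations u_1 … u_l of a path (started at s) where each u_i is taken from
  -- (N(u_{i-1}) ∩ A) \ R_i, with R_1 = R_2 = {s}, R_{i+1} = R_i ∪ {u_{i-1}}.
  -- Called as  ext A l [ s ] s.  With A = everything and no self-loops these are
  -- exactly the simple paths with l edges starting at s.
  ext : (A : Fin n → Bool) → ℕ → List (Fin n) → Fin n → List (List (Fin n))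
  ext A zero R u = [ [] ]
  ext A (suc l) R u = concatMap (λ v → map (v ∷_) (ext A l (u ∷ R) v)) (cands A R u)

  weightAux : (A : Fin n → Bool) → List (Fin n) → Fin n → List (Fin n) → ℚ
  weightAux A R u [] = 1ℚ
  weightAux A R u (v ∷ p) = inv (length (cands A R u)) * weightAux A (u ∷ R) v p

  weight : (A : Fin n → Bool) → Fin n → List (Fin n) → ℚ
  weight A s p = weightAux A [ s ] s p

  allV : Fin n → Bool
  allV _ = true

  𝒲 : Fin n → List (Fin n) → ℚ
  𝒲 = weight allV

  -- The random walk of APAD restricted to A: outcomes (just path | nothing = failure)
  -- together with their probabilities.
  run : (A : Fin n → Bool) → ℕ → List (Fin n) → Fin n → List (Maybe (List (Fin n)) × ℚ)
  run A zero R u = [ (just [] , 1ℚ) ]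
  run A (suc l) R u with cands A R u
  ... | [] = [ (nothing , 1ℚ) ]
  ... | cs@(_ ∷ _) =
    concatMap (λ v → map (λ o → (Data.Maybe.map (v ∷_) (proj₁ o) , inv (length cs) * proj₂ o))
                         (run A l (u ∷ R) v)) cs

oneTo : ℕ → List ℕ
oneTo k = map suc (upTo k)

module Centrality {n : ℕ} (E : Graph n) (k : ℕ) (r : Fin n) where
  open Paths E

  others : List (Fin n)
  others = filterᵇ (λ s → Data.Bool.not (does (s ≟ r))) (allFin n)

  pc : ℚ
  pc = inv k * inv n *
       Σℚ (concatMap (λ s → concatMap (λ l →
             map (λ p → if r ∈ᵇ p then 𝒲 s p else 0ℚ) (ext allV l [ s ] s))
           (oneTo k)) others)

-- Algorithm APAD, given a decision procedure for reachability (any two such procedures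
-- agree, so the result does not depend on the choice).
module APAD {n : ℕ} (E : Graph n) (k : ℕ) (r : Fin n)
            (reach? : ∀ u v → Relation.Nullary.Dec (Reach E u v)) where
  open Paths E

  RF : List (Fin n)
  RF = filterᵇ (λ s → not (does (s ≟ r)) ∧ does (reach? s r)) (allFin n)

  inD : Fin n → Bool
  inD v = does (v ≟ r) ∨ does (reach? v r) ∨ does (reach? r v)

  value : Fin n → Maybe (List (Fin n)) → ℚ
  value s nothing = 0ℚ
  value s (just p) =
    if r ∈ᵇ p
    then (+ length RF / 1) * 𝒲 s p * invℚ ((+ n / 1) * weight inD s p)
    else 0ℚ

  -- distribution of one sample 𝐜_τ : list of (value, probability)
  step : List (ℚ × ℚ)
  step = concatMap (λ s → concatMap (λ l →
           map (λ o → (value s (proj₁ o) , inv (length RF) * inv k * proj₂ o))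
               (run inD l [ s ] s))
         (oneTo k)) RF

  -- distribution of 𝐜_1 + … + 𝐜_t for t independent samples
  sumDist : ℕ → List (ℚ × ℚ)
  sumDist zero = [ (0ℚ , 1ℚ) ]
  sumDist (suc t) = concatMap (λ a → map (λ b → (proj₁ a + proj₁ b , proj₂ a * proj₂ b)) step)
                              (sumDist t)

  deviationProb : (τ : ℕ) → .{{ℕ.NonZero τ}} → ℚ → ℚ
  deviationProb τ λ' =
    Σℚ (map (λ o → if does (λ' ℚ.≤? ℚ.∣ proj₁ o * (+ 1 / τ) ℚ.- Centrality.pc E k r ∣)
                   then proj₂ o else 0ℚ)
            (sumDist τ))

module Submission where

-- One APAD sample 𝐜_τ is an unbiased estimator of pc(r). Sources outside RF contribute nothing
-- to pc(r), since a path from s through r witnesses that s reaches r; a path from s through r never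
-- leaves D, since its vertices before r reach r and those after r are reached from r; and dividing
-- by ℙ[p] cancels the probability with which the walk produces p, leaving exactly the weighted sum
-- that defines pc(r). The τ samples are independent, so their sum has variance τV, where V is the
-- variance of one sample, and Chebyshev's inequality gives ℙ[|𝐜 − pc(r)| ≥ λ] ≤ V/(τλ²), which is
-- at most δ as soon as τ ≥ V/(λ²δ).

open import Defs
open import Data.Nat as ℕ using (ℕ; _≤_; zero; suc; s≤s; z≤n)
import Data.Nat.Properties as ℕP
open import Data.Integer as ℤ using (-[1+_])
import Data.Integer.Properties as ℤP
import Data.Nat.Coprimality as Coprimality
open import Data.Bool using (Bool; true; false; T; not; _∧_; if_then_else_)
open import Data.Bool.Properties using (T-≡; T-∧; ∨-zeroʳ; not-¬)
open import Data.Fin using (Fin; _≟_)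
open import Data.List using (List; []; _∷_; [_]; _++_; map; concatMap; filterᵇ; length; allFin; upTo)
open import Data.Bool.ListAction using (all)
open import Data.List.Properties using (map-++; length-map; length-upTo)
open import Data.List.Relation.Unary.Any using (here; there)
open import Data.List.Membership.Propositional using (_∈_)
open import Data.List.Membership.Propositional.Properties using (∈-filter⁺; ∈-allFin)
open import Data.List.Relation.Unary.All as All using (All; []; _∷_)
import Data.List.Relation.Unary.All.Properties as AllP
open import Data.List.Relation.Unary.Linked using (Linked; [-]; _∷_)
open import Data.Maybe as Maybe using (Maybe; just; nothing; maybe′)
open import Data.Product using (∃; _×_; _,_; proj₁; proj₂; map₂)
open import Data.Sum using (inj₁; inj₂)
open import Data.Empty using (⊥-elim)
open import Data.Rational as ℚ using (ℚ; 0ℚ; 1ℚ; _<_; nonNegative; positive; _+_; _*_; _-_; -_; _/_; ∣_∣; mkℚ; toℚᵘ)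
open import Data.Rational.Properties hiding (_≟_)
import Data.Rational.Unnormalised as ℚᵘ
import Data.Rational.Unnormalised.Properties as ℚᵘP
open import Data.Rational.Solver using (module +-*-Solver)
open import Relation.Nullary using (Dec; yes; no; does; ¬_)
open import Relation.Nullary.Decidable using (dec-true)
open import Relation.Binary.PropositionalEquality hiding ([_])
open import Relation.Binary.Construct.Closure.ReflexiveTransitive using (ε; _◅_; _◅◅_)
open import Function using (_∘_)
open import Function.Bundles using (Equivalence)

-- Rational arithmetic

sq : ℚ → ℚ
sq y = y * y

∣y∣*∣y∣≡sq : ∀ y → ∣ y ∣ * ∣ y ∣ ≡ sq y
∣y∣*∣y∣≡sq y with ∣p∣≡p∨∣p∣≡-p y
... | inj₁ ∣y∣≡y  rewrite ∣y∣≡y  = refl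
... | inj₂ ∣y∣≡-y rewrite ∣y∣≡-y = solve 1 (λ y → (:- y) :* (:- y) := y :* y) refl y
  where open +-*-Solver

*-nonNeg : ∀ {p q} → 0ℚ ℚ.≤ p → 0ℚ ℚ.≤ q → 0ℚ ℚ.≤ p * q
*-nonNeg {p} {q} 0≤p 0≤q =
  nonNegative⁻¹ (p * q) {{nonNeg*nonNeg⇒nonNeg p {{nonNegative 0≤p}} q {{nonNegative 0≤q}}}}

*-pos : ∀ {p q} → 0ℚ < p → 0ℚ < q → 0ℚ < p * q
*-pos {p} {q} 0<p 0<q = positive⁻¹ (p * q) {{pos*pos⇒pos p {{positive 0<p}} q {{positive 0<q}}}}

sq-nonNeg : ∀ y → 0ℚ ℚ.≤ sq y
sq-nonNeg y = subst (0ℚ ℚ.≤_) (∣y∣*∣y∣≡sq y) (*-nonNeg (0≤∣p∣ y) (0≤∣p∣ y))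

invℚ-inverseˡ : ∀ q → q ≢ 0ℚ → invℚ q * q ≡ 1ℚ
invℚ-inverseˡ q q≢0 with q ℚ.≟ 0ℚ
... | yes q≡0 = ⊥-elim (q≢0 q≡0)
... | no  q≢0 = *-inverseˡ q {{ℚ.≢-nonZero q≢0}}

ι : ℕ → ℚ
ι m = ℤ.+ m / 1

private
  ιᵘ : ℕ → ℚᵘ.ℚᵘ
  ιᵘ m = ℚᵘ.mkℚᵘ (ℤ.+ m) 0

  toℚᵘ-ι : ∀ m → toℚᵘ (ι m) ℚᵘ.≃ ιᵘ m
  toℚᵘ-ι m = toℚᵘ-fromℚᵘ (ιᵘ m)

ι-suc : ∀ m → ι (suc m) ≡ 1ℚ + ι m
ι-suc m = toℚᵘ-injective (begin
  toℚᵘ (ι (suc m))          ≈⟨ toℚᵘ-ι (suc m) ⟩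
  ιᵘ (suc m)                ≈⟨ ℚᵘ.*≡* (cong (λ a → (ℤ.+ 1 ℤ.+ a) ℤ.* ℤ.+ 1) (sym (ℤP.*-identityʳ (ℤ.+ m)))) ⟩
  ℚᵘ.1ℚᵘ ℚᵘ.+ ιᵘ m          ≈⟨ ℚᵘP.≃-sym (ℚᵘP.+-congʳ ℚᵘ.1ℚᵘ (toℚᵘ-ι m)) ⟩
  ℚᵘ.1ℚᵘ ℚᵘ.+ toℚᵘ (ι m)    ≈⟨ ℚᵘP.≃-sym (toℚᵘ-homo-+ 1ℚ (ι m)) ⟩
  toℚᵘ (1ℚ + ι m)           ∎)
  where open ℚᵘP.≃-Reasoning

inv-inverseˡ : ∀ m .{{_ : ℕ.NonZero m}} → inv m * ι m ≡ 1ℚ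
inv-inverseˡ (suc m) = toℚᵘ-injective (begin
  toℚᵘ (inv (suc m) * ι (suc m))            ≈⟨ toℚᵘ-homo-* (inv (suc m)) (ι (suc m)) ⟩
  toℚᵘ (inv (suc m)) ℚᵘ.* toℚᵘ (ι (suc m))  ≈⟨ ℚᵘP.*-cong (toℚᵘ-fromℚᵘ (ℚᵘ.mkℚᵘ (ℤ.+ 1) m)) (toℚᵘ-ι (suc m)) ⟩
  ℚᵘ.mkℚᵘ (ℤ.+ 1) m ℚᵘ.* ιᵘ (suc m)           ≈⟨ ℚᵘ.*≡* cross-multiplied ⟩
  ℚᵘ.1ℚᵘ                                    ∎)
  where
  open ℚᵘP.≃-Reasoning
  cross-multiplied : ℤ.+ 1 ℤ.* ℤ.+ suc m ℤ.* ℤ.+ 1 ≡ ℤ.+ 1 ℤ.* ℤ.+ suc (m ℕ.* 1)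
  cross-multiplied = trans (ℤP.*-identityʳ _) (cong (λ a → ℤ.+ 1 ℤ.* ℤ.+ suc a) (sym (ℕP.*-identityʳ m)))

ι-nonNeg : ∀ m → 0ℚ ℚ.≤ ι m
ι-nonNeg m = nonNegative⁻¹ (ι m) {{normalize-nonNeg m 1}}

ι-pos : ∀ m .{{_ : ℕ.NonZero m}} → 0ℚ < ι m
ι-pos m = positive⁻¹ (ι m) {{normalize-pos m 1}}

inv-pos : ∀ m .{{_ : ℕ.NonZero m}} → 0ℚ < inv m
inv-pos (suc m) = positive⁻¹ (inv (suc m)) {{normalize-pos 1 (suc m)}}

inv-nonNeg : ∀ m → 0ℚ ℚ.≤ inv m
inv-nonNeg zero    = ≤-refl
inv-nonNeg (suc m) = <⇒≤ (inv-pos (suc m))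

ι-mono-≤ : ∀ {m n} → m ≤ n → ι m ℚ.≤ ι n
ι-mono-≤ {n = n} z≤n = ι-nonNeg n
ι-mono-≤ {suc m} {suc n} (s≤s m≤n) =
  subst₂ ℚ._≤_ (sym (ι-suc m)) (sym (ι-suc n)) (+-monoʳ-≤ 1ℚ (ι-mono-≤ m≤n))

archimedean : ∀ q → ∃ λ N → q ℚ.≤ ι N
archimedean q@(mkℚ -[1+ _ ] _ _) = 0 , ≤-trans (nonPositive⁻¹ q {{neg⇒nonPos q}}) (ι-nonNeg 0)
archimedean q@(mkℚ (ℤ.+ a) d _)    = a , subst (q ℚ.≤_) (sym ι-a≡a/1)
  (ℚ.*≤* (ℤP.*-monoˡ-≤-nonNeg (ℤ.+ a) (ℤ.+≤+ (s≤s z≤n))))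
  where
  ι-a≡a/1 : ι a ≡ mkℚ (ℤ.+ a) 0 (Coprimality.sym (Coprimality.1-coprimeTo a))
  ι-a≡a/1 = ↥p/↧p≡p _

-- Finite sums over lists

∑ : {A : Set} → (A → ℚ) → List A → ℚ
∑ f xs = Σℚ (map f xs)

Σℚ-++ : (xs ys : List ℚ) → Σℚ (xs ++ ys) ≡ Σℚ xs + Σℚ ys
Σℚ-++ []       ys = sym (+-identityˡ _)
Σℚ-++ (x ∷ xs) ys = trans (cong (x +_) (Σℚ-++ xs ys)) (sym (+-assoc x _ _))

Σℚ-concatMap : {A : Set} (g : A → List ℚ) (xs : List A) →
               Σℚ (concatMap g xs) ≡ ∑ (Σℚ ∘ g) xs
Σℚ-concatMap g []       = refl
Σℚ-concatMap g (x ∷ xs) = trans (Σℚ-++ (g x) _) (cong (Σℚ (g x) +_) (Σℚ-concatMap g xs))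

module _ {A : Set} where

  ∑-++ : (f : A → ℚ) (xs ys : List A) → ∑ f (xs ++ ys) ≡ ∑ f xs + ∑ f ys
  ∑-++ f xs ys = trans (cong Σℚ (map-++ f xs ys)) (Σℚ-++ (map f xs) (map f ys))

  ∑-cong : {f g : A → ℚ} (xs : List A) → (∀ x → f x ≡ g x) → ∑ f xs ≡ ∑ g xs
  ∑-cong []       f≗g = refl
  ∑-cong (x ∷ xs) f≗g = cong₂ _+_ (f≗g x) (∑-cong xs f≗g)

  ∑-cong-All : {f g : A → ℚ} {xs : List A} → All (λ x → f x ≡ g x) xs → ∑ f xs ≡ ∑ g xs
  ∑-cong-All []         = refl
  ∑-cong-All (eq ∷ eqs) = cong₂ _+_ eq (∑-cong-All eqs)

  ∑-+ : (f g : A → ℚ) (xs : List A) → ∑ (λ x → f x + g x) xs ≡ ∑ f xs + ∑ g xs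
  ∑-+ f g []       = refl
  ∑-+ f g (x ∷ xs) = trans (cong (f x + g x +_) (∑-+ f g xs))
    (solve 4 (λ a b c d → a :+ b :+ (c :+ d) := a :+ c :+ (b :+ d)) refl (f x) (g x) (∑ f xs) (∑ g xs))
    where open +-*-Solver

  ∑-*ˡ : (c : ℚ) (f : A → ℚ) (xs : List A) → ∑ (λ x → c * f x) xs ≡ c * ∑ f xs
  ∑-*ˡ c f []       = sym (*-zeroʳ c)
  ∑-*ˡ c f (x ∷ xs) = trans (cong (c * f x +_) (∑-*ˡ c f xs)) (sym (*-distribˡ-+ c (f x) (∑ f xs)))

  ∑-zero : (xs : List A) → ∑ (λ _ → 0ℚ) xs ≡ 0ℚ
  ∑-zero []       = refl
  ∑-zero (x ∷ xs) = cong (0ℚ +_) (∑-zero xs)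

  ∑-mono-≤ : {f g : A → ℚ} {xs : List A} → All (λ x → f x ℚ.≤ g x) xs → ∑ f xs ℚ.≤ ∑ g xs
  ∑-mono-≤ []         = ≤-refl
  ∑-mono-≤ (le ∷ les) = +-mono-≤ le (∑-mono-≤ les)

  ∑-filterᵇ : (q : A → Bool) (f : A → ℚ) (xs : List A) →
              ∑ f (filterᵇ q xs) ≡ ∑ (λ x → if q x then f x else 0ℚ) xs
  ∑-filterᵇ q f []       = refl
  ∑-filterᵇ q f (x ∷ xs) with q x
  ... | true  = cong (f x +_) (∑-filterᵇ q f xs)
  ... | false = trans (∑-filterᵇ q f xs) (sym (+-identityˡ _))

  ∑-filterᵇ-∧ : (P Q : A → Bool) (f : A → ℚ) → (∀ x → Q x ≡ false → f x ≡ 0ℚ) →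
                (xs : List A) → ∑ f (filterᵇ P xs) ≡ ∑ f (filterᵇ (λ x → P x ∧ Q x) xs)
  ∑-filterᵇ-∧ P Q f f≡0 []       = refl
  ∑-filterᵇ-∧ P Q f f≡0 (x ∷ xs) with P x | Q x in Qx
  ... | false | _     = ∑-filterᵇ-∧ P Q f f≡0 xs
  ... | true  | true  = cong (f x +_) (∑-filterᵇ-∧ P Q f f≡0 xs)
  ... | true  | false = trans (cong₂ _+_ (f≡0 x Qx) (∑-filterᵇ-∧ P Q f f≡0 xs)) (+-identityˡ _)

∑-map : {A B : Set} (f : B → ℚ) (g : A → B) (xs : List A) → ∑ f (map g xs) ≡ ∑ (f ∘ g) xs
∑-map f g []       = refl
∑-map f g (x ∷ xs) = cong (f (g x) +_) (∑-map f g xs)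

∑-concatMap : {A B : Set} (f : B → ℚ) (g : A → List B) (xs : List A) →
              ∑ f (concatMap g xs) ≡ ∑ (λ x → ∑ f (g x)) xs
∑-concatMap f g []       = refl
∑-concatMap f g (x ∷ xs) = trans (∑-++ f (g x) (concatMap g xs)) (cong (∑ f (g x) +_) (∑-concatMap f g xs))

∑-concatMap-map : {A B C : Set} (f : C → ℚ) (h : A → B → C) (g : A → List B) (xs : List A) →
                  ∑ f (concatMap (λ x → map (h x) (g x)) xs) ≡ ∑ (λ x → ∑ (f ∘ h x) (g x)) xs
∑-concatMap-map f h g xs = trans (∑-concatMap f _ xs) (∑-cong xs (λ x → ∑-map f (h x) (g x)))

∑-const : {A : Set} (c : ℚ) (xs : List A) → ∑ (λ _ → c) xs ≡ ι (length xs) * c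
∑-const c []       = sym (*-zeroˡ c)
∑-const c (x ∷ xs) = begin
  c + ∑ (λ _ → c) xs         ≡⟨ cong₂ _+_ (sym (*-identityˡ c)) (∑-const c xs) ⟩
  1ℚ * c + ι (length xs) * c ≡⟨ sym (*-distribʳ-+ c 1ℚ (ι (length xs))) ⟩
  (1ℚ + ι (length xs)) * c   ≡⟨ cong (_* c) (sym (ι-suc (length xs))) ⟩
  ι (suc (length xs)) * c    ∎
  where open ≡-Reasoning

nonZero-length : {A : Set} {x : A} {xs : List A} → x ∈ xs → ℕ.NonZero (length xs)
nonZero-length (here _)  = _
nonZero-length (there _) = _

-- Sample means of independent draws

λ²·indicator≤p·y² : ∀ {λ' y p : ℚ} → 0ℚ < λ' → 0ℚ ℚ.≤ p → (λ≤∣y∣? : Dec (λ' ℚ.≤ ∣ y ∣)) →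
                    (λ' * λ') * (if does λ≤∣y∣? then p else 0ℚ) ℚ.≤ p * sq y
λ²·indicator≤p·y² {λ'} {y} {p} 0<λ 0≤p (yes λ≤∣y∣) = begin
  (λ' * λ') * p      ≤⟨ *-monoʳ-≤-nonNeg p {{nonNegative 0≤p}} λ²≤∣y∣² ⟩
  ∣ y ∣ * ∣ y ∣ * p  ≡⟨ cong (_* p) (∣y∣*∣y∣≡sq y) ⟩
  sq y * p           ≡⟨ *-comm (sq y) p ⟩
  p * sq y           ∎
  where
  open ≤-Reasoning
  λ²≤∣y∣² : λ' * λ' ℚ.≤ ∣ y ∣ * ∣ y ∣
  λ²≤∣y∣² = ≤-trans (*-monoʳ-≤-nonNeg λ' {{nonNegative (<⇒≤ 0<λ)}} λ≤∣y∣)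
                    (*-monoˡ-≤-nonNeg ∣ y ∣ {{∣-∣-nonNeg y}} λ≤∣y∣)
λ²·indicator≤p·y² {λ'} {y} {p} 0<λ 0≤p (no _) =
  subst (ℚ._≤ p * sq y) (sym (*-zeroʳ (λ' * λ'))) (*-nonNeg 0≤p (sq-nonNeg y))

-- A finite distribution is a list of (value, probability) pairs.
module IID (D : List (ℚ × ℚ)) where

  iidSum : ℕ → List (ℚ × ℚ)
  iidSum zero    = [ (0ℚ , 1ℚ) ]
  iidSum (suc t) = concatMap (λ a → map (λ b → (proj₁ a + proj₁ b , proj₂ a * proj₂ b)) D) (iidSum t)

  ∑-iidSum-suc : (f : ℚ × ℚ → ℚ) (t : ℕ) → ∑ f (iidSum (suc t)) ≡
                 ∑ (λ a → ∑ (λ b → f (proj₁ a + proj₁ b , proj₂ a * proj₂ b)) D) (iidSum t)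
  ∑-iidSum-suc f t = ∑-concatMap-map f _ (λ _ → D) (iidSum t)

  iidSum-nonNeg : All (λ b → 0ℚ ℚ.≤ proj₂ b) D → ∀ t → All (λ a → 0ℚ ℚ.≤ proj₂ a) (iidSum t)
  iidSum-nonNeg D≥0 zero    = <⇒≤ (positive⁻¹ 1ℚ) ∷ []
  iidSum-nonNeg D≥0 (suc t) = AllP.concat⁺ (AllP.map⁺ (All.map
    (λ a≥0 → AllP.map⁺ (All.map (*-nonNeg a≥0) D≥0)) (iidSum-nonNeg D≥0 t)))

  iidSum-mass : ∑ proj₂ D ≡ 1ℚ → ∀ t → ∑ proj₂ (iidSum t) ≡ 1ℚ
  iidSum-mass mass zero    = +-identityʳ 1ℚ
  iidSum-mass mass (suc t) = begin
    ∑ proj₂ (iidSum (suc t))                               ≡⟨ ∑-iidSum-suc proj₂ t ⟩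
    ∑ (λ a → ∑ (λ b → proj₂ a * proj₂ b) D) (iidSum t)     ≡⟨ ∑-cong (iidSum t) mass·a ⟩
    ∑ proj₂ (iidSum t)                                     ≡⟨ iidSum-mass mass t ⟩
    1ℚ                                                     ∎
    where
    open ≡-Reasoning
    mass·a : ∀ a → ∑ (λ b → proj₂ a * proj₂ b) D ≡ proj₂ a
    mass·a a = trans (∑-*ˡ (proj₂ a) proj₂ D) (trans (cong (proj₂ a *_) mass) (*-identityʳ _))

  deviationProb : ℚ → (τ : ℕ) → .{{_ : ℕ.NonZero τ}} → ℚ → ℚ
  deviationProb μ τ λ' =
    ∑ (λ o → if does (λ' ℚ.≤? ∣ proj₁ o * (ℤ.+ 1 / τ) - μ ∣) then proj₂ o else 0ℚ) (iidSum τ)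

  module Moments (μ : ℚ) (mass : ∑ proj₂ D ≡ 1ℚ) (mean : ∑ (λ b → proj₂ b * proj₁ b) D ≡ μ) where

    variance : ℚ
    variance = ∑ (λ b → proj₂ b * sq (proj₁ b - μ)) D

    centred : ∑ (λ b → proj₂ b * (proj₁ b - μ)) D ≡ 0ℚ
    centred = begin
      ∑ (λ b → proj₂ b * (proj₁ b - μ)) D
        ≡⟨ ∑-cong D (λ b → solve 3 (λ p x m → p :* (x :- m) := p :* x :+ (:- m) :* p)
                                   refl (proj₂ b) (proj₁ b) μ) ⟩
      ∑ (λ b → proj₂ b * proj₁ b + - μ * proj₂ b) D
        ≡⟨ ∑-+ _ _ D ⟩
      ∑ (λ b → proj₂ b * proj₁ b) D + ∑ (λ b → - μ * proj₂ b) D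
        ≡⟨ cong₂ _+_ mean (trans (∑-*ˡ (- μ) proj₂ D) (cong (- μ *_) mass)) ⟩
      μ + - μ * 1ℚ
        ≡⟨ trans (cong (μ +_) (*-identityʳ (- μ))) (+-inverseʳ μ) ⟩
      0ℚ ∎
      where
      open ≡-Reasoning
      open +-*-Solver

    -- Expanding the square, the cross term vanishes because the new draw is centred.
    one-more-draw : ∀ t a → ∑ (λ b → (proj₂ a * proj₂ b) * sq ((proj₁ a + proj₁ b) - ι (suc t) * μ)) D
                            ≡ proj₂ a * sq (proj₁ a - ι t * μ) + variance * proj₂ a
    one-more-draw t (x , p) = begin
      ∑ (λ b → (p * proj₂ b) * sq ((x + proj₁ b) - ι (suc t) * μ)) D
        ≡⟨ ∑-cong D (λ b → expand (proj₁ b) (proj₂ b)) ⟩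
      ∑ (λ b → c₁ * proj₂ b + (c₂ * dev b + p * dev² b)) D
        ≡⟨ ∑-+ (λ b → c₁ * proj₂ b) _ D ⟩
      ∑ (λ b → c₁ * proj₂ b) D + ∑ (λ b → c₂ * dev b + p * dev² b) D
        ≡⟨ cong₂ _+_ (∑-*ˡ c₁ proj₂ D) (trans (∑-+ (λ b → c₂ * dev b) _ D)
                                             (cong₂ _+_ (∑-*ˡ c₂ dev D) (∑-*ˡ p dev² D))) ⟩
      c₁ * ∑ proj₂ D + (c₂ * ∑ dev D + p * variance)
        ≡⟨ cong₂ (λ m c → c₁ * m + (c₂ * c + p * variance)) mass centred ⟩
      c₁ * 1ℚ + (c₂ * 0ℚ + p * variance)
        ≡⟨ solve 4 (λ p s c v → (p :* s) :* con 1ℚ :+ (c :* con 0ℚ :+ p :* v) := p :* s :+ v :* p)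
                   refl p (sq e) c₂ variance ⟩
      p * sq e + variance * p ∎
      where
      open ≡-Reasoning
      open +-*-Solver
      e = x - ι t * μ
      c₁ = p * sq e
      c₂ = p * (e + e)
      dev dev² : ℚ × ℚ → ℚ
      dev b = proj₂ b * (proj₁ b - μ)
      dev² b = proj₂ b * sq (proj₁ b - μ)
      expand : ∀ y q → (p * q) * sq ((x + y) - ι (suc t) * μ)
                       ≡ c₁ * q + (c₂ * (q * (y - μ)) + p * (q * sq (y - μ)))
      expand y q rewrite ι-suc t =
        solve 6 (λ p x y q i m →
          (p :* q) :* (((x :+ y) :- (con 1ℚ :+ i) :* m) :* ((x :+ y) :- (con 1ℚ :+ i) :* m))
          := (p :* ((x :- i :* m) :* (x :- i :* m))) :* q
             :+ ((p :* ((x :- i :* m) :+ (x :- i :* m))) :* (q :* (y :- m))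
             :+ p :* (q :* ((y :- m) :* (y :- m))))) refl p x y q (ι t) μ

    iidSum-variance : ∀ t → ∑ (λ a → proj₂ a * sq (proj₁ a - ι t * μ)) (iidSum t) ≡ ι t * variance
    iidSum-variance zero = solve 2 (λ m v → con 1ℚ :* ((con 0ℚ :- con 0ℚ :* m) :* (con 0ℚ :- con 0ℚ :* m))
                                           :+ con 0ℚ := con 0ℚ :* v) refl μ variance
      where open +-*-Solver
    iidSum-variance (suc t) = begin
      ∑ (λ a → proj₂ a * sq (proj₁ a - ι (suc t) * μ)) (iidSum (suc t))
        ≡⟨ ∑-iidSum-suc _ t ⟩
      ∑ (λ a → ∑ (λ b → (proj₂ a * proj₂ b) * sq ((proj₁ a + proj₁ b) - ι (suc t) * μ)) D) (iidSum t)
        ≡⟨ ∑-cong (iidSum t) (one-more-draw t) ⟩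
      ∑ (λ a → proj₂ a * sq (proj₁ a - ι t * μ) + variance * proj₂ a) (iidSum t)
        ≡⟨ ∑-+ _ _ (iidSum t) ⟩
      ∑ (λ a → proj₂ a * sq (proj₁ a - ι t * μ)) (iidSum t) + ∑ (λ a → variance * proj₂ a) (iidSum t)
        ≡⟨ cong₂ _+_ (iidSum-variance t) (∑-*ˡ variance proj₂ (iidSum t)) ⟩
      ι t * variance + variance * ∑ proj₂ (iidSum t)
        ≡⟨ cong (λ m → ι t * variance + variance * m) (iidSum-mass mass t) ⟩
      ι t * variance + variance * 1ℚ
        ≡⟨ solve 2 (λ i v → i :* v :+ v :* con 1ℚ := (con 1ℚ :+ i) :* v) refl (ι t) variance ⟩
      (1ℚ + ι t) * variance
        ≡⟨ cong (_* variance) (sym (ι-suc t)) ⟩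
      ι (suc t) * variance ∎
      where
      open ≡-Reasoning
      open +-*-Solver
    chebyshev : All (λ b → 0ℚ ℚ.≤ proj₂ b) D → ∀ τ .{{_ : ℕ.NonZero τ}} λ' → 0ℚ < λ' →
                (λ' * λ') * deviationProb μ τ λ' ℚ.≤ inv τ * variance
    chebyshev D≥0 τ@(suc t) λ' 0<λ = begin
      (λ' * λ') * deviationProb μ τ λ'
        ≡⟨ sym (∑-*ˡ (λ' * λ') _ (iidSum τ)) ⟩
      ∑ (λ o → (λ' * λ') * (if does (λ' ℚ.≤? ∣ proj₁ o * i - μ ∣) then proj₂ o else 0ℚ)) (iidSum τ)
        ≤⟨ ∑-mono-≤ (All.map (λ {o} o≥0 → λ²·indicator≤p·y² 0<λ o≥0 (λ' ℚ.≤? ∣ proj₁ o * i - μ ∣))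
                            (iidSum-nonNeg D≥0 τ)) ⟩
      ∑ (λ o → proj₂ o * sq (proj₁ o * i - μ)) (iidSum τ)
        ≡⟨ ∑-cong (iidSum τ) (λ o → rescale (proj₁ o) (proj₂ o)) ⟩
      ∑ (λ o → (i * i) * (proj₂ o * sq (proj₁ o - ι τ * μ))) (iidSum τ)
        ≡⟨ ∑-*ˡ (i * i) _ (iidSum τ) ⟩
      (i * i) * ∑ (λ o → proj₂ o * sq (proj₁ o - ι τ * μ)) (iidSum τ)
        ≡⟨ cong ((i * i) *_) (iidSum-variance τ) ⟩
      (i * i) * (ι τ * variance)
        ≡⟨ solve 3 (λ i T V → (i :* i) :* (T :* V) := i :* (i :* T) :* V) refl i (ι τ) variance ⟩
      i * (i * ι τ) * variance
        ≡⟨ cong (λ z → i * z * variance) (inv-inverseˡ τ) ⟩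
      i * 1ℚ * variance
        ≡⟨ cong (_* variance) (*-identityʳ i) ⟩
      i * variance ∎
      where
      open ≤-Reasoning
      open +-*-Solver
      i = inv τ
      rescale : ∀ x p → p * sq (x * i - μ) ≡ (i * i) * (p * sq (x - ι τ * μ))
      rescale x p = begin-equality
        p * sq (x * i - μ)             ≡⟨ cong (λ z → p * sq (x * i - z)) (sym (*-identityʳ μ)) ⟩
        p * sq (x * i - μ * 1ℚ)        ≡⟨ cong (λ z → p * sq (x * i - μ * z)) (sym (inv-inverseˡ τ)) ⟩
        p * sq (x * i - μ * (i * ι τ))
          ≡⟨ solve 5 (λ p x i m T → p :* ((x :* i :- m :* (i :* T)) :* (x :* i :- m :* (i :* T)))
                        := (i :* i) :* (p :* ((x :- T :* m) :* (x :- T :* m)))) refl p x i μ (ι τ) ⟩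
        (i * i) * (p * sq (x - ι τ * μ)) ∎

    weak-law : All (λ b → 0ℚ ℚ.≤ proj₂ b) D → (λ' δ : ℚ) → 0ℚ < λ' → 0ℚ < δ →
               ∃ λ T → (τ : ℕ) → T ≤ τ → .{{_ : ℕ.NonZero τ}} → deviationProb μ τ λ' ℚ.≤ δ
    weak-law D≥0 λ' δ 0<λ 0<δ = suc N , deviation≤δ
      where
      c = (λ' * λ') * δ
      instance
        λ²-pos : ℚ.Positive (λ' * λ')
        λ²-pos = pos*pos⇒pos λ' {{positive 0<λ}} λ' {{positive 0<λ}}
        c-pos : ℚ.Positive c
        c-pos = pos*pos⇒pos (λ' * λ') δ {{positive 0<δ}}
        c≢0 : ℚ.NonZero c
        c≢0 = pos⇒nonZero c
        c≥0 : ℚ.NonNegative c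
        c≥0 = pos⇒nonNeg c
      N : ℕ
      N = proj₁ (archimedean (variance * ℚ.1/ c))
      variance/c≤N : variance * ℚ.1/ c ℚ.≤ ι N
      variance/c≤N = proj₂ (archimedean (variance * ℚ.1/ c))
      variance≤τc : ∀ τ → N ≤ τ → variance ℚ.≤ ι τ * c
      variance≤τc τ N≤τ = begin
        variance                     ≡⟨ sym (*-identityʳ variance) ⟩
        variance * 1ℚ                ≡⟨ cong (variance *_) (sym (*-inverseˡ c)) ⟩
        variance * (ℚ.1/ c * c)      ≡⟨ sym (*-assoc variance _ c) ⟩
        variance * ℚ.1/ c * c        ≤⟨ *-monoʳ-≤-nonNeg c (≤-trans variance/c≤N (ι-mono-≤ N≤τ)) ⟩
        ι τ * c                      ∎
        where open ≤-Reasoning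
      deviation≤δ : (τ : ℕ) → suc N ≤ τ → .{{_ : ℕ.NonZero τ}} → deviationProb μ τ λ' ℚ.≤ δ
      deviation≤δ τ@(suc t) (s≤s N≤t) = *-cancelˡ-≤-pos (λ' * λ') (begin
        (λ' * λ') * deviationProb μ τ λ' ≤⟨ chebyshev D≥0 τ λ' 0<λ ⟩
        inv τ * variance               ≤⟨ *-monoˡ-≤-nonNeg (inv τ) {{nonNegative (inv-nonNeg τ)}}
                                                          (variance≤τc τ (ℕP.m≤n⇒m≤1+n N≤t)) ⟩
        inv τ * (ι τ * c)              ≡⟨ sym (*-assoc (inv τ) (ι τ) c) ⟩
        (inv τ * ι τ) * c              ≡⟨ cong (_* c) (inv-inverseˡ τ) ⟩
        1ℚ * c                         ≡⟨ *-identityˡ c ⟩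
        (λ' * λ') * δ                  ∎)
        where open ≤-Reasoning

-- Enumerated paths and the sampling walk

module _ {n : ℕ} (E : Graph n) where
  open Paths E

  ∑-cands : ∀ A R u (h : Fin n → ℚ) →
            ∑ h (cands A R u) ≡ ∑ (λ v → if A v then h v else 0ℚ) (cands allV R u)
  ∑-cands A R u h = begin
    ∑ h (cands A R u)
      ≡⟨ ∑-filterᵇ _ h (allFin n) ⟩
    ∑ (λ v → if E u v ∧ A v ∧ not (v ∈ᵇ R) then h v else 0ℚ) (allFin n)
      ≡⟨ ∑-cong (allFin n) move-guard ⟩
    ∑ (λ v → if E u v ∧ true ∧ not (v ∈ᵇ R) then (if A v then h v else 0ℚ) else 0ℚ) (allFin n)
      ≡⟨ sym (∑-filterᵇ _ _ (allFin n)) ⟩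
    ∑ (λ v → if A v then h v else 0ℚ) (cands allV R u) ∎
    where
    open ≡-Reasoning
    move-guard : ∀ v → (if E u v ∧ A v ∧ not (v ∈ᵇ R) then h v else 0ℚ)
                       ≡ (if E u v ∧ true ∧ not (v ∈ᵇ R) then (if A v then h v else 0ℚ) else 0ℚ)
    move-guard v with E u v | A v | not (v ∈ᵇ R)
    ... | false | _     | _     = refl
    ... | true  | true  | _     = refl
    ... | true  | false | true  = refl
    ... | true  | false | false = refl

  ∑-ext-restrict : ∀ A l R u (f : List (Fin n) → ℚ) →
                   ∑ f (ext A l R u) ≡ ∑ (λ p → if all A p then f p else 0ℚ) (ext allV l R u)
  ∑-ext-restrict A zero    R u f = refl
  ∑-ext-restrict A (suc l) R u f = begin
    ∑ f (ext A (suc l) R u)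
      ≡⟨ ∑-concatMap-map f _ _ (cands A R u) ⟩
    ∑ (λ v → ∑ (f ∘ (v ∷_)) (ext A l (u ∷ R) v)) (cands A R u)
      ≡⟨ ∑-cong (cands A R u) (λ v → ∑-ext-restrict A l (u ∷ R) v (f ∘ (v ∷_))) ⟩
    ∑ (λ v → ∑ (λ p → if all A p then f (v ∷ p) else 0ℚ) (ext allV l (u ∷ R) v)) (cands A R u)
      ≡⟨ ∑-cands A R u _ ⟩
    ∑ (λ v → if A v then ∑ (λ p → if all A p then f (v ∷ p) else 0ℚ) (ext allV l (u ∷ R) v) else 0ℚ)
      (cands allV R u)
      ≡⟨ ∑-cong (cands allV R u) guard-inside ⟩
    ∑ (λ v → ∑ (λ p → if all A (v ∷ p) then f (v ∷ p) else 0ℚ) (ext allV l (u ∷ R) v)) (cands allV R u)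
      ≡⟨ sym (∑-concatMap-map _ _ _ (cands allV R u)) ⟩
    ∑ (λ p → if all A p then f p else 0ℚ) (ext allV (suc l) R u) ∎
    where
    open ≡-Reasoning
    guard-inside : ∀ v →
      (if A v then ∑ (λ p → if all A p then f (v ∷ p) else 0ℚ) (ext allV l (u ∷ R) v) else 0ℚ)
      ≡ ∑ (λ p → if all A (v ∷ p) then f (v ∷ p) else 0ℚ) (ext allV l (u ∷ R) v)
    guard-inside v with A v
    ... | true  = refl
    ... | false = sym (∑-zero (ext allV l (u ∷ R) v))

  extendOutcome : List (Fin n) → Fin n → Maybe (List (Fin n)) × ℚ → Maybe (List (Fin n)) × ℚ
  extendOutcome cs v (p , P) = (Maybe.map (v ∷_) p , inv (length cs) * P)

  ∑-run : ∀ A l R u (g : Maybe (List (Fin n)) → ℚ) → g nothing ≡ 0ℚ →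
          ∑ (g ∘ proj₁) (run A l R u) ≡ ∑ (g ∘ just) (ext A l R u)
  ∑-run A zero    R u g g0 = refl
  ∑-run A (suc l) R u g g0 with cands A R u
  ... | []         = trans (cong (_+ 0ℚ) g0) (+-identityʳ 0ℚ)
  ... | cs@(_ ∷ _) =
    trans (∑-concatMap-map (g ∘ proj₁) (extendOutcome cs) (run A l (u ∷ R)) cs)
   (trans (∑-cong cs (λ v → ∑-run A l (u ∷ R) v (g ∘ Maybe.map (v ∷_)) g0))
          (sym (∑-concatMap-map (g ∘ just) _∷_ (ext A l (u ∷ R)) cs)))

  run-mass : ∀ A l R u → ∑ proj₂ (run A l R u) ≡ 1ℚ
  run-mass A zero    R u = +-identityʳ 1ℚ
  run-mass A (suc l) R u with cands A R u
  ... | []         = +-identityʳ 1ℚ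
  ... | cs@(_ ∷ _) = trans (∑-concatMap-map proj₂ (extendOutcome cs) (run A l (u ∷ R)) cs) (begin
    ∑ (λ v → ∑ (λ o → inv (length cs) * proj₂ o) (run A l (u ∷ R) v)) cs
      ≡⟨ ∑-cong cs (λ v → trans (∑-*ˡ (inv (length cs)) proj₂ (run A l (u ∷ R) v))
                               (trans (cong (inv (length cs) *_) (run-mass A l (u ∷ R) v))
                                      (*-identityʳ (inv (length cs))))) ⟩
    ∑ (λ _ → inv (length cs)) cs     ≡⟨ ∑-const (inv (length cs)) cs ⟩
    ι (length cs) * inv (length cs)  ≡⟨ *-comm (ι (length cs)) _ ⟩
    inv (length cs) * ι (length cs)  ≡⟨ inv-inverseˡ (length cs) ⟩
    1ℚ                               ∎)
    where open ≡-Reasoning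

  WellWeighted : (A : Fin n → Bool) → List (Fin n) → Fin n → Maybe (List (Fin n)) × ℚ → Set
  WellWeighted A R u (nothing , P) = 0ℚ ℚ.≤ P
  WellWeighted A R u (just p  , P) = P ≡ weightAux A R u p × 0ℚ < P

  run-wellWeighted : ∀ A l R u → All (WellWeighted A R u) (run A l R u)
  run-wellWeighted A zero    R u = (refl , positive⁻¹ 1ℚ) ∷ []
  run-wellWeighted A (suc l) R u with cands A R u in cands≡cs
  ... | []         = <⇒≤ (positive⁻¹ 1ℚ) ∷ []
  ... | cs@(_ ∷ _) = AllP.concat⁺ (AllP.map⁺ (All.universal (λ v →
                       AllP.map⁺ (All.map (extend v _) (run-wellWeighted A l (u ∷ R) v))) cs))
    where
    extend : ∀ v o → WellWeighted A (u ∷ R) v o → WellWeighted A R u (extendOutcome cs v o)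
    extend v (nothing , P) P≥0       = *-nonNeg (inv-nonNeg (length cs)) P≥0
    extend v (just p  , P) (P≡w , P>0) =
      cong₂ _*_ (cong (inv ∘ length) (sym cands≡cs)) P≡w , *-pos (inv-pos (length cs)) P>0

  wellWeighted-nonNeg : ∀ {A R u} o → WellWeighted A R u o → 0ℚ ℚ.≤ proj₂ o
  wellWeighted-nonNeg (nothing , P) P≥0       = P≥0
  wellWeighted-nonNeg (just _  , P) (_ , P>0) = <⇒≤ P>0

  cands-edges : ∀ A R u → All (Edge E u) (cands A R u)
  cands-edges A R u = All.map (λ uv∧ → Equivalence.to T-≡ (proj₁ (Equivalence.to T-∧ uv∧)))
                              (AllP.all-filter _ (allFin n))

  ext-walks : ∀ A l R u → All (λ p → Linked (Edge E) (u ∷ p)) (ext A l R u)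
  ext-walks A zero    R u = [-] ∷ []
  ext-walks A (suc l) R u = AllP.concat⁺ (AllP.map⁺ (All.map
    (λ {v} uv → AllP.map⁺ (All.map (uv ∷_) (ext-walks A l (u ∷ R) v))) (cands-edges A R u)))

  walk-reaches : ∀ {u} r p → Linked (Edge E) (u ∷ p) → r ∈ᵇ p ≡ true → Reach E u r
  walk-reaches r (v ∷ p) (uv ∷ walk) r∈p with r ≟ v
  ... | yes refl = uv ◅ ε
  ... | no  _    = uv ◅ walk-reaches r p walk r∈p

-- Unbiasedness of one APAD sample

module _ {n : ℕ} (E : Graph n) (k : ℕ) (r : Fin n) (reach? : ∀ u v → Dec (Reach E u v)) where
  open Paths E
  open APAD E k r reach?
  open Centrality E k r

  inD-reaching : ∀ {v} → Reach E v r → inD v ≡ true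
  inD-reaching {v} v↝r rewrite dec-true (reach? v r) v↝r = ∨-zeroʳ (does (v ≟ r))

  inD-reached : ∀ {v} → Reach E r v → inD v ≡ true
  inD-reached {v} r↝v rewrite dec-true (reach? r v) r↝v | ∨-zeroʳ (does (reach? v r)) =
    ∨-zeroʳ (does (v ≟ r))

  walk-from-reached-⊆D : ∀ {u} p → Reach E r u → Linked (Edge E) (u ∷ p) → all inD p ≡ true
  walk-from-reached-⊆D []      r↝u _           = refl
  walk-from-reached-⊆D (v ∷ p) r↝u (uv ∷ walk) rewrite inD-reached (r↝u ◅◅ (uv ◅ ε)) =
    walk-from-reached-⊆D p (r↝u ◅◅ (uv ◅ ε)) walk

  walk-via-r-⊆D : ∀ {u} p → Linked (Edge E) (u ∷ p) → r ∈ᵇ p ≡ true → all inD p ≡ true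
  walk-via-r-⊆D (v ∷ p) (uv ∷ walk) r∈ with r ≟ v
  ... | yes refl rewrite dec-true (r ≟ r) refl = walk-from-reached-⊆D p ε walk
  ... | no  _    rewrite inD-reaching (walk-reaches E r p walk r∈) = walk-via-r-⊆D p walk r∈

  deviationProb≡ : ∀ τ .{{_ : ℕ.NonZero τ}} λ' → deviationProb τ λ' ≡ IID.deviationProb step pc τ λ'
  deviationProb≡ τ λ' = cong (∑ (λ o → if does (λ' ℚ.≤? ∣ proj₁ o * (ℤ.+ 1 / τ) - pc ∣) then proj₂ o else 0ℚ))
                             (sumDist≡iidSum τ)
    where
    sumDist≡iidSum : ∀ t → sumDist t ≡ IID.iidSum step t
    sumDist≡iidSum zero    = refl
    sumDist≡iidSum (suc t) = cong (concatMap _) (sumDist≡iidSum t)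

  RF-nonZero : NoSelfLoops E → ∃ (λ u → Edge E u r) → ℕ.NonZero (length RF)
  RF-nonZero noLoops (u , ur) = nonZero-length (∈-filter⁺ _ (∈-allFin u) u∈RF)
    where
    u∈RF : T (not (does (u ≟ r)) ∧ does (reach? u r))
    u∈RF with u ≟ r
    ... | yes refl = ⊥-elim (not-¬ ur (noLoops r))
    ... | no  _    = Equivalence.from T-≡ (dec-true (reach? u r) (ur ◅ ε))

  χ𝒲 : Fin n → List (Fin n) → ℚ
  χ𝒲 s p = if r ∈ᵇ p then 𝒲 s p else 0ℚ

  ∑-χ𝒲-⊆D : ∀ s l → ∑ (χ𝒲 s) (ext allV l [ s ] s) ≡ ∑ (χ𝒲 s) (ext inD l [ s ] s)
  ∑-χ𝒲-⊆D s l = sym (trans (∑-ext-restrict E inD l [ s ] s (χ𝒲 s))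
                           (∑-cong-All (All.map (λ {p} → drop-guard p) (ext-walks E allV l [ s ] s))))
    where
    drop-guard : ∀ p → Linked (Edge E) (s ∷ p) → (if all inD p then χ𝒲 s p else 0ℚ) ≡ χ𝒲 s p
    drop-guard p walk with r ∈ᵇ p in r∈
    ... | true rewrite walk-via-r-⊆D p walk r∈ = refl
    ... | false with all inD p
    ...   | true  = refl
    ...   | false = refl

  ∑-χ𝒲-unreaching : ∀ s l → ¬ Reach E s r → ∑ (χ𝒲 s) (ext allV l [ s ] s) ≡ 0ℚ
  ∑-χ𝒲-unreaching s l s↛r = trans (∑-cong-All (All.map (λ {p} → vanish p) (ext-walks E allV l [ s ] s)))
                                   (∑-zero (ext allV l [ s ] s))
    where
    vanish : ∀ p → Linked (Edge E) (s ∷ p) → χ𝒲 s p ≡ 0ℚ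
    vanish p walk with r ∈ᵇ p in r∈
    ... | true  = ⊥-elim (s↛r (walk-reaches E r p walk r∈))
    ... | false = refl

  pc≡∑RF : pc ≡ inv k * inv n * ∑ (λ s → ∑ (λ l → ∑ (χ𝒲 s) (ext inD l [ s ] s)) (oneTo k)) RF
  pc≡∑RF = cong (inv k * inv n *_) (begin
    Σℚ (concatMap (λ s → concatMap (λ l → map (χ𝒲 s) (ext allV l [ s ] s)) (oneTo k)) others)
      ≡⟨ Σℚ-concatMap _ others ⟩
    ∑ (λ s → Σℚ (concatMap (λ l → map (χ𝒲 s) (ext allV l [ s ] s)) (oneTo k))) others
      ≡⟨ ∑-cong others (λ s → Σℚ-concatMap _ (oneTo k)) ⟩
    ∑ (λ s → ∑ (λ l → ∑ (χ𝒲 s) (ext allV l [ s ] s)) (oneTo k)) others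
      ≡⟨ ∑-filterᵇ-∧ _ (λ s → does (reach? s r)) _ unreaching-vanish (allFin n) ⟩
    ∑ (λ s → ∑ (λ l → ∑ (χ𝒲 s) (ext allV l [ s ] s)) (oneTo k)) RF
      ≡⟨ ∑-cong RF (λ s → ∑-cong (oneTo k) (∑-χ𝒲-⊆D s)) ⟩
    ∑ (λ s → ∑ (λ l → ∑ (χ𝒲 s) (ext inD l [ s ] s)) (oneTo k)) RF ∎)
    where
    open ≡-Reasoning
    unreaching-vanish : ∀ s → does (reach? s r) ≡ false →
                        ∑ (λ l → ∑ (χ𝒲 s) (ext allV l [ s ] s)) (oneTo k) ≡ 0ℚ
    unreaching-vanish s _ with reach? s r
    ... | no s↛r = trans (∑-cong (oneTo k) (λ l → ∑-χ𝒲-unreaching s l s↛r)) (∑-zero (oneTo k))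

  module Unbiased .{{_ : ℕ.NonZero n}} .{{_ : ℕ.NonZero k}} .{{_ : ℕ.NonZero (length RF)}} where

    selectionProb : ℚ
    selectionProb = inv (length RF) * inv k

    ∑-step : (f : ℚ × ℚ → ℚ) → ∑ f step ≡
      ∑ (λ s → ∑ (λ l → ∑ (λ o → f (value s (proj₁ o) , selectionProb * proj₂ o)) (run inD l [ s ] s))
                 (oneTo k)) RF
    ∑-step f = trans (∑-concatMap f _ RF) (∑-cong RF (λ s → ∑-concatMap-map f _ _ (oneTo k)))

    step-nonNeg : All (λ b → 0ℚ ℚ.≤ proj₂ b) step
    step-nonNeg = AllP.concat⁺ (AllP.map⁺ (All.universal (λ s →
      AllP.concat⁺ (AllP.map⁺ (All.universal (λ l →
        AllP.map⁺ (All.map (λ {o} → *-nonNeg selectionProb-nonNeg ∘ wellWeighted-nonNeg E o)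
                           (run-wellWeighted E inD l [ s ] s))) (oneTo k)))) RF))
      where
      selectionProb-nonNeg : 0ℚ ℚ.≤ selectionProb
      selectionProb-nonNeg = *-nonNeg (inv-nonNeg (length RF)) (inv-nonNeg k)

    step-mass : ∑ proj₂ step ≡ 1ℚ
    step-mass = begin
      ∑ proj₂ step
        ≡⟨ ∑-step proj₂ ⟩
      ∑ (λ s → ∑ (λ l → ∑ (λ o → selectionProb * proj₂ o) (run inD l [ s ] s)) (oneTo k)) RF
        ≡⟨ ∑-cong RF (λ s → ∑-cong (oneTo k) (λ l → run-total s l)) ⟩
      ∑ (λ s → ∑ (λ l → selectionProb) (oneTo k)) RF
        ≡⟨ ∑-cong RF (λ s → trans (∑-const selectionProb (oneTo k))
                                  (cong (λ m → ι m * selectionProb) ∣oneTo∣)) ⟩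
      ∑ (λ s → ι k * selectionProb) RF
        ≡⟨ ∑-const (ι k * selectionProb) RF ⟩
      ι (length RF) * (ι k * (inv (length RF) * inv k))
        ≡⟨ solve 4 (λ a b x y → a :* (b :* (x :* y)) := (x :* a) :* (y :* b))
                   refl (ι (length RF)) (ι k) (inv (length RF)) (inv k) ⟩
      (inv (length RF) * ι (length RF)) * (inv k * ι k)
        ≡⟨ cong₂ _*_ (inv-inverseˡ (length RF)) (inv-inverseˡ k) ⟩
      1ℚ * 1ℚ
        ≡⟨ *-identityʳ 1ℚ ⟩
      1ℚ ∎
      where
      open ≡-Reasoning
      open +-*-Solver
      run-total : ∀ s l → ∑ (λ o → selectionProb * proj₂ o) (run inD l [ s ] s) ≡ selectionProb
      run-total s l = trans (∑-*ˡ selectionProb proj₂ (run inD l [ s ] s))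
                            (trans (cong (selectionProb *_) (run-mass E inD l [ s ] s)) (*-identityʳ _))
      ∣oneTo∣ : length (oneTo k) ≡ k
      ∣oneTo∣ = trans (length-map suc (upTo k)) (length-upTo k)

    importance-weight : ∀ s o → WellWeighted E inD [ s ] s o →
      (selectionProb * proj₂ o) * value s (proj₁ o) ≡ inv k * inv n * maybe′ (χ𝒲 s) 0ℚ (proj₁ o)
    importance-weight s (nothing , P) _ = trans (*-zeroʳ (selectionProb * P)) (sym (*-zeroʳ (inv k * inv n)))
    importance-weight s (just p , .(weightAux inD [ s ] s p)) (refl , w>0) with r ∈ᵇ p
    ... | false = trans (*-zeroʳ (selectionProb * weightAux inD [ s ] s p)) (sym (*-zeroʳ (inv k * inv n)))
    ... | true  = begin
      (c * w) * (ι (length RF) * W * invℚ (ι n * w))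
        ≡⟨ sym (*-identityʳ _) ⟩
      (c * w) * (ι (length RF) * W * invℚ (ι n * w)) * 1ℚ
        ≡⟨ cong ((c * w) * (ι (length RF) * W * invℚ (ι n * w)) *_) (sym (inv-inverseˡ n)) ⟩
      (c * w) * (ι (length RF) * W * invℚ (ι n * w)) * (inv n * ι n)
        ≡⟨ solve 8 (λ a b x y W w I m → ((a :* b) :* w) :* (x :* W :* I) :* (y :* m)
                                       := (a :* x) :* (b :* y :* W) :* (I :* (m :* w)))
                   refl (inv (length RF)) (inv k) (ι (length RF)) (inv n) W w (invℚ (ι n * w)) (ι n) ⟩
      (inv (length RF) * ι (length RF)) * (inv k * inv n * W) * (invℚ (ι n * w) * (ι n * w))
        ≡⟨ cong₂ (λ a b → a * (inv k * inv n * W) * b)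
                 (inv-inverseˡ (length RF)) (invℚ-inverseˡ (ι n * w) (≢-sym (<⇒≢ (*-pos (ι-pos n) w>0)))) ⟩
      1ℚ * (inv k * inv n * W) * 1ℚ
        ≡⟨ trans (*-identityʳ _) (*-identityˡ _) ⟩
      inv k * inv n * W ∎
      where
      open ≡-Reasoning
      open +-*-Solver
      c = selectionProb
      w = weightAux inD [ s ] s p
      W = 𝒲 s p

    step-mean : ∑ (λ b → proj₂ b * proj₁ b) step ≡ pc
    step-mean = begin
      ∑ (λ b → proj₂ b * proj₁ b) step
        ≡⟨ ∑-step _ ⟩
      ∑ (λ s → ∑ (λ l → ∑ (λ o → (selectionProb * proj₂ o) * value s (proj₁ o)) (run inD l [ s ] s))
                 (oneTo k)) RF
        ≡⟨ ∑-cong RF (λ s → ∑-cong (oneTo k) (per-walk s)) ⟩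
      ∑ (λ s → ∑ (λ l → inv k * inv n * ∑ (χ𝒲 s) (ext inD l [ s ] s)) (oneTo k)) RF
        ≡⟨ ∑-cong RF (λ s → ∑-*ˡ (inv k * inv n) (λ l → ∑ (χ𝒲 s) (ext inD l [ s ] s)) (oneTo k)) ⟩
      ∑ (λ s → inv k * inv n * ∑ (λ l → ∑ (χ𝒲 s) (ext inD l [ s ] s)) (oneTo k)) RF
        ≡⟨ ∑-*ˡ (inv k * inv n) _ RF ⟩
      inv k * inv n * ∑ (λ s → ∑ (λ l → ∑ (χ𝒲 s) (ext inD l [ s ] s)) (oneTo k)) RF
        ≡⟨ sym pc≡∑RF ⟩
      pc ∎
      where
      open ≡-Reasoning
      per-walk : ∀ s l → ∑ (λ o → (selectionProb * proj₂ o) * value s (proj₁ o)) (run inD l [ s ] s)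
                         ≡ inv k * inv n * ∑ (χ𝒲 s) (ext inD l [ s ] s)
      per-walk s l = begin
        ∑ (λ o → (selectionProb * proj₂ o) * value s (proj₁ o)) (run inD l [ s ] s)
          ≡⟨ ∑-cong-All (All.map (λ {o} → importance-weight s o) (run-wellWeighted E inD l [ s ] s)) ⟩
        ∑ (λ o → inv k * inv n * maybe′ (χ𝒲 s) 0ℚ (proj₁ o)) (run inD l [ s ] s)
          ≡⟨ ∑-*ˡ (inv k * inv n) _ (run inD l [ s ] s) ⟩
        inv k * inv n * ∑ (maybe′ (χ𝒲 s) 0ℚ ∘ proj₁) (run inD l [ s ] s)
          ≡⟨ cong (inv k * inv n *_) (∑-run E inD l [ s ] s (maybe′ (χ𝒲 s) 0ℚ) refl) ⟩
        inv k * inv n * ∑ (χ𝒲 s) (ext inD l [ s ] s) ∎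

theorem5p2 : (n : ℕ) (E : Graph n) → NoSelfLoops E → WeaklyConnected E →
    (k : ℕ) → 1 ≤ k → (r : Fin n) →
    ∃ (λ u → Edge E u r) → ∃ (λ v → Edge E r v) →
    (λ' δ : ℚ) → 0ℚ < λ' → λ' < 1ℚ → 0ℚ < δ → δ < 1ℚ →
    (reach? : ∀ u v → Dec (Reach E u v)) →
    ∃ (λ T → (τ : ℕ) → T ≤ τ → .{{_ : ℕ.NonZero τ}} →
      APAD.deviationProb E k r reach? τ λ' ℚ.≤ δ)
theorem5p2 (suc _) E noLoops _ k@(suc _) (s≤s z≤n) r into-r _ λ' δ 0<λ _ 0<δ _ reach? =
  map₂ (λ bound τ T≤τ → subst (ℚ._≤ δ) (sym (deviationProb≡ E k r reach? τ λ')) (bound τ T≤τ))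
       (weak-law step-nonNeg λ' δ 0<λ 0<δ)
  where
  open APAD E k r reach? using (RF; step)
  instance
    RF≢0 : ℕ.NonZero (length RF)
    RF≢0 = RF-nonZero E k r reach? noLoops into-r
  open Unbiased E k r reach?
  open IID.Moments step (Centrality.pc E k r) step-mass step-mean
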